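{- Let $\chi_{\Pi}(n)=1$ if $n$ is a prime power (i.e. $n=p^j$ for a prime $p$ and integer $j\geq 1$) and $\chi_{\Pi}(n)=0$ otherwise. Then the sequence $(\chi_{\Pi}(n))_{n\geq 1}$ is not $k$-automatic for any integer $k\geq 2$.
   Context: A sequence $(t(n))_{n\geq 1}$ taking values in a finite set is $k$-automatic (for an integer $k\geq 2$) if its $k$-kernel $\{(t(k^l n+r))_{n}: l\geq 0,\ 0\leq r<k^l\}$ is finite. -}

module Defs where

open import Data.Nat using (ℕ; zero; suc; _+_; _*_; _^_; _≤_; _<_)
open import Data.Product using (Σ; _×_; ∃-syntax)
open import Data.List using (List)
open import Data.List.Relation.Unary.Any using (Any)
open import Relation.Binary.PropositionalEquality using (_≡_)
open import Data.Nat.Primality using (Prime)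
open import Relation.Nullary using (¬_)

-- A sequence (t(n))_{n ≥ 1} is modelled as a function ℕ → A, of which only
-- the values at n ≥ 1 matter (the value at 0 is irrelevant).

_≈ₛ_ : {A : Set} → (ℕ → A) → (ℕ → A) → Set
s ≈ₛ u = ∀ n → 1 ≤ n → s n ≡ u n

kernelElem : {A : Set} → (ℕ → A) → ℕ → ℕ → ℕ → (ℕ → A)
kernelElem t k l r n = t (k ^ l * n + r)

KernelFinite : {A : Set} → ℕ → (ℕ → A) → Set
KernelFinite {A} k t =
  Σ (List (ℕ → A)) λ L →
    ∀ (l r : ℕ) → r < k ^ l → Any (λ s → kernelElem t k l r ≈ₛ s) L

Automatic : {A : Set} → ℕ → (ℕ → A) → Set
Automatic k t = KernelFinite k t

IsPrimePower : ℕ → Set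
IsPrimePower n = ∃[ p ] ∃[ j ] (Prime p × 1 ≤ j × n ≡ p ^ j)

IsChiΠ : (ℕ → ℕ) → Set
IsChiΠ χ = ∀ n → 1 ≤ n → (IsPrimePower n → χ n ≡ 1) × (¬ IsPrimePower n → χ n ≡ 0)

{-# OPTIONS --safe #-}
module Submission where

-- Let N be the length of a finite list covering the k-kernel, p a prime not dividing k and
-- X = p ^ J with J = k ^ N (so that k ^ a ≤ X for all a ≤ N). Among the N + 1 kernel elements
-- n ↦ χ (k ^ l * n + X mod k ^ l), l ≤ N, two coincide, at l = a and l = a + d; hence
-- t n = χ (k ^ a * n + r) satisfies t n = t (k ^ d * n + y). Along the affine orbit of
-- z = X / k ^ a under n ↦ k ^ d * n + y, t keeps its value t z = χ X = 1. As k ^ d is a unit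
-- modulo p ^ (J + 1), the orbit returns to z modulo p ^ (J + 1) at some u > z, and then
-- k ^ a * u + r = p ^ J + p ^ (J + 1) * c with c ≥ 1, which is no prime power: t u = 0.

open import Defs
open import Data.Nat using (ℕ; zero; suc; _+_; _*_; _^_; _<_; _≤_; _∸_; z≤n; s≤s; s≤s⁻¹; NonZero)
open import Data.Nat.Base using (nonTrivial⇒≢1; nonTrivial⇒n>1; >-nonZero; >-nonZero⁻¹)
open import Data.Nat.Properties
open import Data.Nat.Divisibility
open import Data.Nat.DivMod
open import Data.Nat.Primality
open import Data.Nat.Primality.Factorisation using (factorise)
open import Data.Nat.Tactic.RingSolver using (solve-∀)
open import Data.Fin using (Fin; toℕ)
open import Data.Fin.Properties using (pigeonhole; toℕ<n; toℕ-fromℕ<)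
open import Data.List using (List; []; _∷_; length; lookup)
open import Data.List.Relation.Unary.All using (_∷_)
open import Data.List.Relation.Unary.Any using (Any; index)
open import Data.List.Relation.Unary.Any.Properties using (lookup-index)
open import Data.Product using (_,_; _×_; ∃-syntax; proj₁; proj₂)
open import Data.Sum using (inj₁; inj₂)
open import Data.Empty using (⊥-elim)
open import Function using (_∘_)
open import Relation.Nullary using (¬_; yes; no)
open import Relation.Binary.PropositionalEquality

n<m^n : ∀ {m} → 1 < m → ∀ n → n < m ^ n
n<m^n {m@(suc _)} 1<m zero = s≤s z≤n
n<m^n {m@(suc _)} 1<m (suc n) = begin-strict
  suc n         ≤⟨ n<m^n 1<m n ⟩
  m ^ n         <⟨ m<m+n (m ^ n) (m^n>0 m n) ⟩
  m ^ n + m ^ n ≡⟨ cong (m ^ n +_) (+-identityʳ (m ^ n)) ⟨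
  2 * m ^ n     ≤⟨ *-monoˡ-≤ (m ^ n) 1<m ⟩
  m * m ^ n     ∎
  where open ≤-Reasoning

^-monoʳ-∣ : ∀ p {m n} → m ≤ n → p ^ m ∣ p ^ n
^-monoʳ-∣ p {m} {n} m≤n = divides (p ^ (n ∸ m)) (begin
  p ^ n                 ≡⟨ cong (p ^_) (m+[n∸m]≡n m≤n) ⟨
  p ^ (m + (n ∸ m))     ≡⟨ ^-distribˡ-+-* p m (n ∸ m) ⟩
  p ^ m * p ^ (n ∸ m)   ≡⟨ *-comm (p ^ m) _ ⟩
  p ^ (n ∸ m) * p ^ m   ∎)
  where open ≡-Reasoning

%-≡⇒∣ : ∀ a b M .{{_ : NonZero M}} → a % M ≡ (a + b) % M → M ∣ b
%-≡⇒∣ a b M eq = ∣m+n∣m⇒∣n (subst (M ∣_) (sym quotients) (n∣m*n ((a + b) / M))) (n∣m*n (a / M))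
  where
  open ≡-Reasoning
  quotients : a / M * M + b ≡ (a + b) / M * M
  quotients = +-cancelˡ-≡ (a % M) _ _ (begin
    a % M + (a / M * M + b)   ≡⟨ +-assoc (a % M) _ b ⟨
    a % M + a / M * M + b     ≡⟨ cong (_+ b) (m≡m%n+[m/n]*n a M) ⟨
    a + b                     ≡⟨ m≡m%n+[m/n]*n (a + b) M ⟩
    (a + b) % M + (a + b) / M * M ≡⟨ cong (_+ (a + b) / M * M) eq ⟨
    a % M + (a + b) / M * M   ∎)

prime⇒>1 : ∀ {p} → Prime p → 1 < p
prime⇒>1 {p} pp = nonTrivial⇒n>1 p {{prime⇒nonTrivial pp}}

prime⇒≢1 : ∀ {p} → Prime p → p ≢ 1
prime⇒≢1 pp = nonTrivial⇒≢1 {{prime⇒nonTrivial pp}}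

prime⇒∤1 : ∀ {p} → Prime p → ¬ p ∣ 1
prime⇒∤1 pp = prime⇒≢1 pp ∘ ∣1⇒≡1

∃prime∣ : ∀ n → 2 ≤ n → ∃[ p ] Prime p × p ∣ n
∃prime∣ n@(suc _) 2≤n with factorise n
... | record { factors = [] ; isFactorisation = n≡1 } = ⊥-elim (<⇒≢ 2≤n (sym n≡1))
... | record { factors = p ∷ ps ; isFactorisation = n≡p*ps ; factorsPrime = pp ∷ _ } =
  p , pp , subst (p ∣_) (sym n≡p*ps) (m∣m*n _)

∃prime∤ : ∀ k → 1 ≤ k → ∃[ p ] Prime p × ¬ p ∣ k
∃prime∤ k 1≤k with ∃prime∣ (suc k) (s≤s 1≤k)
... | p , pp , p∣1+k = p , pp , λ p∣k → prime⇒∤1 pp (∣m+n∣m⇒∣n (subst (p ∣_) (+-comm 1 k) p∣1+k) p∣k)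

prime∣prime⇒≡ : ∀ {p q} → Prime p → Prime q → p ∣ q → p ≡ q
prime∣prime⇒≡ pp pq p∣q with prime⇒irreducible pq p∣q
... | inj₁ p≡1 = ⊥-elim (prime⇒≢1 pp p≡1)
... | inj₂ p≡q = p≡q

prime∣^⇒∣ : ∀ {p m} → Prime p → ∀ t → p ∣ m ^ t → p ∣ m
prime∣^⇒∣ pp zero p∣1 = ⊥-elim (prime⇒∤1 pp p∣1)
prime∣^⇒∣ {m = m} pp (suc t) p∣m^[1+t] with euclidsLemma m (m ^ t) pp p∣m^[1+t]
... | inj₁ p∣m = p∣m
... | inj₂ p∣m^t = prime∣^⇒∣ pp t p∣m^t

prime^-divisor : ∀ {p m} → Prime p → ¬ p ∣ m → ∀ s {n} → p ^ s ∣ m * n → p ^ s ∣ n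
prime^-divisor pp p∤m zero _ = 1∣ _
prime^-divisor {p} {m} pp p∤m (suc s) {n} p^[1+s]∣m*n
  with euclidsLemma m n pp (∣-trans (m∣m*n (p ^ s)) p^[1+s]∣m*n)
... | inj₁ p∣m = ⊥-elim (p∤m p∣m)
... | inj₂ (divides n′ refl) =
  subst (p ^ suc s ∣_) (*-comm p n′) (*-monoʳ-∣ p (prime^-divisor pp p∤m s p^s∣m*n′))
  where
  instance _ = prime⇒nonZero pp
  p^s∣m*n′ : p ^ s ∣ m * n′
  p^s∣m*n′ = *-cancelˡ-∣ p (subst (p ^ suc s ∣_) (trans (sym (*-assoc m n′ p)) (*-comm (m * n′) p))
                                  p^[1+s]∣m*n)

¬IsPrimePower[p^j+p^[1+j]*c] : ∀ {p j c} → Prime p → 1 ≤ j → 1 ≤ c →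
                               ¬ IsPrimePower (p ^ j + p ^ suc j * c)
¬IsPrimePower[p^j+p^[1+j]*c] {p} {j} {c} pp 1≤j 1≤c (q , t , pq , _ , n≡q^t)
  with prime∣prime⇒≡ pp pq (prime∣^⇒∣ pp t (subst (p ∣_) n≡q^t p∣n))
  where
  p∣n : p ∣ p ^ j + p ^ suc j * c
  p∣n = ∣-trans (subst (_∣ p ^ j) (*-identityʳ p) (^-monoʳ-∣ p 1≤j))
                (∣m∣n⇒∣m+n ∣-refl (∣m⇒∣m*n c (n∣m*n p)))
... | refl with t ≤? j
...   | yes t≤j = <-irrefl (sym n≡q^t) (≤-<-trans (^-monoʳ-≤ p t≤j) (m<m+n (p ^ j) p^[1+j]*c>0))
  where
  instance _ = prime⇒nonZero pp
  p^[1+j]*c>0 : 0 < p ^ suc j * c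
  p^[1+j]*c>0 = *-mono-≤ (m^n>0 p (suc j)) 1≤c
...   | no t≰j = <⇒≱ (^-monoʳ-< p (prime⇒>1 pp) (n<1+n j)) (∣⇒≤ {{m^n≢0 p j}} p^[1+j]∣p^j)
  where
  instance _ = prime⇒nonZero pp
  p^[1+j]∣p^j : p ^ suc j ∣ p ^ j
  p^[1+j]∣p^j = ∣m+n∣m⇒∣n (subst (p ^ suc j ∣_) (trans (sym n≡q^t) (+-comm (p ^ j) _))
                                              (^-monoʳ-∣ p (≰⇒> t≰j)))
                          (m∣m*n c)

<⇒∃+ : ∀ {m n} → m < n → ∃[ d ] 1 ≤ d × m + d ≡ n
<⇒∃+ {m} {n} m<n = n ∸ m , m<n⇒0<n∸m m<n , m+[n∸m]≡n (<⇒≤ m<n)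

pigeonholeℕ : ∀ N (f : ℕ → Fin N) → ∃[ i ] ∃[ j ] i < j × j ≤ N × f i ≡ f j
pigeonholeℕ N f with i , j , i<j , fi≡fj ← pigeonhole (n<1+n N) (f ∘ toℕ) =
  toℕ i , toℕ j , i<j , s≤s⁻¹ (toℕ<n j) , fi≡fj

%-pigeonhole : ∀ M .{{_ : NonZero M}} (f : ℕ → ℕ) → ∃[ i ] ∃[ j ] i < j × f i % M ≡ f j % M
%-pigeonhole M f with i , j , i<j , _ , fi≡fj ← pigeonholeℕ M (λ i → f i mod M) =
  i , j , i<j , trans (sym (toℕ-fromℕ< _)) (trans (cong toℕ fi≡fj) (toℕ-fromℕ< _))

≈ₛ-pigeonhole : ∀ {A : Set} (L : List (ℕ → A)) (s : ℕ → ℕ → A) → (∀ l → Any (s l ≈ₛ_) L) →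
                ∃[ a ] ∃[ b ] a < b × b ≤ length L × s a ≈ₛ s b
≈ₛ-pigeonhole L s covered
  with a , b , a<b , b≤N , same ← pigeonholeℕ (length L) (index ∘ covered) =
  a , b , a<b , b≤N , λ n 1≤n → begin
    s a n                            ≡⟨ lookup-index (covered a) n 1≤n ⟩
    lookup L (index (covered a)) n   ≡⟨ cong (λ i → lookup L i n) same ⟩
    lookup L (index (covered b)) n   ≡⟨ lookup-index (covered b) n 1≤n ⟨
    s b n                            ∎
  where open ≡-Reasoning

SelfSimilar : {A : Set} → (ℕ → A) → ℕ → ℕ → Set
SelfSimilar t K y = ∀ n → 1 ≤ n → t n ≡ t (K * n + y)

module AffineOrbit (K y z : ℕ) where

  orbit : ℕ → ℕ
  orbit zero    = z
  orbit (suc i) = K * orbit i + y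

  orbit-shift : ∀ {m D} → orbit m ≡ z + D → ∀ i → orbit (i + m) ≡ orbit i + K ^ i * D
  orbit-shift {D = D} orbit-m≡ zero = trans orbit-m≡ (cong (z +_) (sym (*-identityˡ D)))
  orbit-shift {m} {D} orbit-m≡ (suc i) = begin
    K * orbit (i + m) + y               ≡⟨ cong (λ u → K * u + y) (orbit-shift orbit-m≡ i) ⟩
    K * (orbit i + K ^ i * D) + y       ≡⟨ rearrange K (orbit i) (K ^ i) D y ⟩
    K * orbit i + y + K * K ^ i * D     ∎
    where
    open ≡-Reasoning
    rearrange : ∀ K u v D y → K * (u + v * D) + y ≡ K * u + y + K * v * D
    rearrange = solve-∀

  module _ (2≤K : 2 ≤ K) (1≤z : 1 ≤ z) where

    orbit-positive : ∀ i → 1 ≤ orbit i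
    orbit-increasing : ∀ i → orbit i < orbit (suc i)

    orbit-positive zero = 1≤z
    orbit-positive (suc i) = ≤-trans (orbit-positive i) (<⇒≤ (orbit-increasing i))

    orbit-increasing i = begin-strict
      orbit i              <⟨ m<m+n (orbit i) (orbit-positive i) ⟩
      orbit i + orbit i    ≡⟨ cong (orbit i +_) (+-identityʳ (orbit i)) ⟨
      2 * orbit i          ≤⟨ *-monoˡ-≤ (orbit i) 2≤K ⟩
      K * orbit i          ≤⟨ m≤m+n (K * orbit i) y ⟩
      K * orbit i + y      ∎
      where open ≤-Reasoning

    z<orbit : ∀ m → 1 ≤ m → z < orbit m
    z<orbit (suc zero)    _ = orbit-increasing 0
    z<orbit (suc (suc m)) _ = <-trans (z<orbit (suc m) (s≤s z≤n)) (orbit-increasing (suc m))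

    orbit-invariant : ∀ {A : Set} (t : ℕ → A) → SelfSimilar t K y → ∀ i → t (orbit i) ≡ t z
    orbit-invariant t selfSimilar zero = refl
    orbit-invariant t selfSimilar (suc i) =
      trans (sym (selfSimilar (orbit i) (orbit-positive i))) (orbit-invariant t selfSimilar i)

    -- By pigeonhole orbit i ≡ orbit (i + m) modulo p ^ s; the difference is K ^ i * (orbit m ∸ z),
    -- and K is invertible modulo p ^ s.
    orbit-returns : ∀ {p} → Prime p → ¬ p ∣ K → ∀ s → ∃[ m ] ∃[ c ] 1 ≤ c × orbit m ≡ z + p ^ s * c
    orbit-returns {p} pp p∤K s
      with i , j , i<j , same ← %-pigeonhole (p ^ s) {{m^n≢0 p s {{prime⇒nonZero pp}}}} orbit
      with m , 1≤m , refl ← <⇒∃+ i<j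
      with D , 0<D , orbit-m≡ ← <⇒∃+ (z<orbit m 1≤m) =
      m , c , c>0 , trans (sym orbit-m≡) (cong (z +_) (trans D≡c*p^s (*-comm c (p ^ s))))
      where
      instance _ = m^n≢0 p s {{prime⇒nonZero pp}}
      p^s∣D : p ^ s ∣ D
      p^s∣D = prime^-divisor pp (p∤K ∘ prime∣^⇒∣ pp i) s
                (%-≡⇒∣ (orbit i) _ (p ^ s) (trans same (cong (_% p ^ s) (orbit-shift (sym orbit-m≡) i))))
      open _∣_ p^s∣D renaming (quotient to c; equality to D≡c*p^s)
      c>0 : 0 < c
      c>0 = >-nonZero⁻¹ c {{m*n≢0⇒m≢0 c {{subst NonZero D≡c*p^s (>-nonZero 0<D)}}}}

residue : ∀ k .{{_ : NonZero k}} → ℕ → ℕ → ℕ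
residue k l X = (X % k ^ l) {{m^n≢0 k l}}

residue-split : ∀ k .{{_ : NonZero k}} a d X →
                ∃[ y ] ∀ n → k ^ (a + d) * n + residue k (a + d) X ≡ k ^ a * (k ^ d * n + y) + residue k a X
residue-split k a d X = R / k ^ a , λ n → begin
  k ^ (a + d) * n + R                                 ≡⟨ cong₂ _+_ (cong (_* n) (^-distribˡ-+-* k a d))
                                                                  (m≡m%n+[m/n]*n R (k ^ a)) ⟩
  k ^ a * k ^ d * n + (R % k ^ a + R / k ^ a * k ^ a) ≡⟨ cong (λ r → k ^ a * k ^ d * n + (r + R / k ^ a * k ^ a))
                                                                (m∣n⇒o%n%m≡o%m (k ^ a) (k ^ (a + d)) X k^a∣k^[a+d]) ⟩
  k ^ a * k ^ d * n + (X % k ^ a + R / k ^ a * k ^ a) ≡⟨ rearrange (k ^ a) (k ^ d) n (X % k ^ a) (R / k ^ a) ⟩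
  k ^ a * (k ^ d * n + R / k ^ a) + X % k ^ a         ∎
  where
  open ≡-Reasoning
  instance
    _ = m^n≢0 k a
    _ = m^n≢0 k (a + d)
  R = X % k ^ (a + d)
  k^a∣k^[a+d] : k ^ a ∣ k ^ (a + d)
  k^a∣k^[a+d] = ^-monoʳ-∣ k (m≤m+n a d)
  rearrange : ∀ A B n r q → A * B * n + (r + q * A) ≡ A * (B * n + q) + r
  rearrange = solve-∀

finiteKernel⇒selfSimilar : ∀ {A : Set} (t : ℕ → A) k .{{_ : NonZero k}} X (L : List (ℕ → A)) →
  (∀ l r → r < k ^ l → Any (kernelElem t k l r ≈ₛ_) L) →
  ∃[ a ] ∃[ d ] ∃[ y ] a ≤ length L × 1 ≤ d × SelfSimilar (kernelElem t k a (residue k a X)) (k ^ d) y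
finiteKernel⇒selfSimilar t k X L cover
  with a , b , a<b , b≤N , same ← ≈ₛ-pigeonhole L (λ l → kernelElem t k l (residue k l X))
                                    (λ l → cover l _ (m%n<n X (k ^ l) {{m^n≢0 k l}}))
  with d , 1≤d , refl ← <⇒∃+ a<b
  with y , split ← residue-split k a d X =
  a , d , y , ≤-trans (m≤m+n a d) b≤N , 1≤d ,
  λ n 1≤n → trans (same n 1≤n) (cong t (split n))

χΠ-¬SelfSimilar : ∀ {χ} → IsChiΠ χ → ∀ {p J K A y z r} → Prime p → 1 ≤ J → ¬ p ∣ K → 2 ≤ K →
                  1 ≤ A → 1 ≤ z → A * z + r ≡ p ^ J → ¬ SelfSimilar (λ n → χ (A * n + r)) K y
χΠ-¬SelfSimilar {χ} χΠ {p} {J} {K} {A} {y} {z} {r} pp 1≤J p∤K 2≤K 1≤A 1≤z Az+r≡p^J selfSimilar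
  with m , c , 1≤c , orbit-m≡ ← AffineOrbit.orbit-returns K y z 2≤K 1≤z pp p∤K (suc J) = 1+n≢0 (begin
    1                             ≡⟨ proj₁ (χΠ (p ^ J) (m^n>0 p J)) (p , J , pp , 1≤J , refl) ⟨
    χ (p ^ J)                     ≡⟨ cong χ Az+r≡p^J ⟨
    χ (A * z + r)                 ≡⟨ orbit-invariant 2≤K 1≤z (λ n → χ (A * n + r)) selfSimilar m ⟨
    χ (A * orbit m + r)           ≡⟨ cong χ A*orbit-m+r≡ ⟩
    χ (p ^ J + p ^ suc J * (A * c)) ≡⟨ proj₂ (χΠ _ (≤-trans (m^n>0 p J) (m≤m+n _ _)))
                                        (¬IsPrimePower[p^j+p^[1+j]*c] pp 1≤J (*-mono-≤ 1≤A 1≤c)) ⟩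
    0                             ∎)
  where
  open AffineOrbit K y z
  open ≡-Reasoning
  instance _ = prime⇒nonZero pp
  A*orbit-m+r≡ : A * orbit m + r ≡ p ^ J + p ^ suc J * (A * c)
  A*orbit-m+r≡ = begin
    A * orbit m + r                   ≡⟨ cong (λ u → A * u + r) orbit-m≡ ⟩
    A * (z + p ^ suc J * c) + r       ≡⟨ rearrange A z (p ^ suc J) c r ⟩
    A * z + r + p ^ suc J * (A * c)   ≡⟨ cong (_+ p ^ suc J * (A * c)) Az+r≡p^J ⟩
    p ^ J + p ^ suc J * (A * c)       ∎
    where
    rearrange : ∀ A z M c r → A * (z + M * c) + r ≡ A * z + r + M * (A * c)
    rearrange = solve-∀

proposition2p3 : (χ : ℕ → ℕ) → IsChiΠ χ → (k : ℕ) → 2 ≤ k → ¬ Automatic k χ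
proposition2p3 χ χΠ k@(suc _) 2≤k (L , cover)
  with p , pp , p∤k ← ∃prime∤ k (s≤s z≤n)
  with a , d , y , a≤N , 1≤d , selfSimilar ← finiteKernel⇒selfSimilar χ k (p ^ k ^ length L) L cover =
  χΠ-¬SelfSimilar χΠ pp (m^n>0 k (length L)) (p∤k ∘ prime∣^⇒∣ pp d) 2≤k^d (m^n>0 k a) 1≤z
                  (sym X≡k^a*z+r) selfSimilar
  where
  instance _ = m^n≢0 k a
  X = p ^ k ^ length L
  z = X / k ^ a
  2≤k^d : 2 ≤ k ^ d
  2≤k^d = ≤-trans 2≤k (subst (_≤ k ^ d) (*-identityʳ k) (^-monoʳ-≤ k 1≤d))
  1≤z : 1 ≤ z
  1≤z = m≥n⇒m/n>0 (<⇒≤ (≤-<-trans (^-monoʳ-≤ k a≤N) (n<m^n (prime⇒>1 pp) (k ^ length L))))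
  X≡k^a*z+r : X ≡ k ^ a * z + residue k a X
  X≡k^a*z+r = trans (m≡m%n+[m/n]*n X (k ^ a))
                    (trans (+-comm _ (z * k ^ a)) (cong (_+ X % k ^ a) (*-comm z (k ^ a))))
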